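{- Let $k\ge 1$ be an integer and let $\mathcal{D}_k$ denote the set of Dyck paths of length $2k$. For $p\in\mathcal{D}_k$ and $0\le i\le k-1$, let $R_i(p)$ be the number of rise steps of $p$ going from altitude $i$ to altitude $i+1$, and let $\vec R(p)=(R_0(p),\dots,R_{k-1}(p))$. Let $E$ denote expectation with respect to the uniform distribution on $\mathcal{D}_k$. Then \[ \| E[\vec{R}]\|_2^2 \;=\; \frac{1}{C_k^2}\sum_{p_1,p_2\in\mathcal{D}_k}\sum_{i=0}^{k-1} R_i(p_1)R_i(p_2) \;=\; \frac{C_{2k}}{C_k^2}-1, \] where $C_m=\frac{1}{m+1}\binom{2m}{m}$ is the $m$-th Catalan number.
   Context: A Dyck path of length $2k$ is a lattice path made of $2k$ steps, each either a rise $(1,1)$ or a fall $(1,-1)$, starting at $(0,0)$, ending at $(2k,0)$, and never going below the $x$-axis. The altitude of a point is its $y$-coordinate. $|\mathcal{D}_k|=C_k$. -}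

module Defs where

open import Data.Bool using (Bool; true; false)
open import Data.Nat using (ℕ; zero; suc; _+_; _*_; _≤_; z≤n; s≤s; NonZero; _/_)
open import Data.Nat.Properties using (m*n≢0; m≤n*m)
open import Data.Nat.Combinatorics using (_C_)
open import Data.List using (List; []; _∷_; map; concatMap; filter; sum; length; upTo)
open import Data.Vec using (Vec; []; _∷_)
open import Data.Integer using (ℤ; +_)
open import Data.Rational using (ℚ; _-_; 1ℚ)
import Data.Rational as ℚ
open import Relation.Nullary using (Dec; yes; no)
open import Relation.Unary using (Decidable)
open import Data.Unit using (⊤; tt)
open import Data.Empty using (⊥)

-- A step: true = rise (1,1), false = fall (1,-1).
Step : Set
Step = Bool

DyckFrom : ℕ → {n : ℕ} → Vec Step n → Set
DyckFrom zero    []            = ⊤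
DyckFrom (suc h) []            = ⊥
DyckFrom zero    (true  ∷ s)   = DyckFrom 1 s
DyckFrom (suc h) (true  ∷ s)   = DyckFrom (suc (suc h)) s
DyckFrom zero    (false ∷ s)   = ⊥
DyckFrom (suc h) (false ∷ s)   = DyckFrom h s

dyckFrom? : ∀ h {n} (s : Vec Step n) → Dec (DyckFrom h s)
dyckFrom? zero    []          = yes tt
dyckFrom? (suc h) []          = no (λ ())
dyckFrom? zero    (true  ∷ s) = dyckFrom? 1 s
dyckFrom? (suc h) (true  ∷ s) = dyckFrom? (suc (suc h)) s
dyckFrom? zero    (false ∷ s) = no (λ ())
dyckFrom? (suc h) (false ∷ s) = dyckFrom? h s

IsDyck : {n : ℕ} → Vec Step n → Set
IsDyck = DyckFrom 0

allWords : (n : ℕ) → List (Vec Step n)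
allWords zero    = [] ∷ []
allWords (suc n) = concatMap (λ w → (true ∷ w) ∷ (false ∷ w) ∷ []) (allWords n)

𝒟 : (k : ℕ) → List (Vec Step (2 * k))
𝒟 k = filter (λ s → dyckFrom? 0 s) (allWords (2 * k))

risesFrom : ℕ → ℕ → {n : ℕ} → Vec Step n → ℕ
risesFrom i h []          = 0
risesFrom i h (true  ∷ s) with i Data.Nat.≟ h
... | yes _ = suc (risesFrom i (suc h) s)
... | no  _ = risesFrom i (suc h) s
risesFrom i h (false ∷ s) = risesFrom i (h Data.Nat.∸ 1) s

R : ℕ → {n : ℕ} → Vec Step n → ℕ
R i p = risesFrom i 0 p

nCk>0 : ∀ n k → k ≤ n → NonZero (n C k)
nCk>0 n       zero    _         = _
nCk>0 (suc n) (suc k) (s≤s k≤n) = helper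
  where
  open import Data.Nat.Combinatorics using (nCk+nC[k+1]≡[n+1]C[k+1])
  open import Relation.Binary.PropositionalEquality using (subst)
  helper : NonZero (suc n C suc k)
  helper = subst NonZero (nCk+nC[k+1]≡[n+1]C[k+1] n k) (plus (nCk>0 n k k≤n))
    where
    plus : ∀ {a b} → NonZero a → NonZero (a + b)
    plus {suc a} _ = _

catalanℚ : ℕ → ℚ
catalanℚ m = (+ ((2 * m) C m)) ℚ./ suc m

central : ℕ → ℕ
central k = (2 * k) C k

central-nonZero : ∀ k → NonZero (central k)
central-nonZero k = nCk>0 (2 * k) k (m≤n*m k 2)

central²-nonZero : ∀ k → NonZero (central k * central k)
central²-nonZero k = m*n≢0 (central k) (central k) {{central-nonZero k}} {{central-nonZero k}}

invCatalan² : ℕ → ℚ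
invCatalan² k = ((+ (suc k * suc k)) ℚ./ (central k * central k)) {{central²-nonZero k}}

Σ[_]_ : {A : Set} → List A → (A → ℚ) → ℚ
Σ[ xs ] f = Data.List.foldr (λ x acc → f x ℚ.+ acc) ℚ.0ℚ xs

-- Expectation of a ℕ-valued function under the uniform distribution on 𝒟_k:
-- (1/C_k) Σ_p f(p), with 1/C_k = (k+1)/binom(2k,k).
E : (k : ℕ) → (Vec Step (2 * k) → ℕ) → ℚ
E k f = ((+ suc k) ℚ./ central k) {{central-nonZero k}} ℚ.* Σ[ 𝒟 k ] (λ p → + f p ℚ./ 1)

normSqER : ℕ → ℚ
normSqER k = Σ[ upTo k ] (λ i → E k (R i) ℚ.* E k (R i))

-- Let A_i be the number of rises from altitude i to i + 1 summed over all Dyck paths of length 2k,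
-- so that E[R_i] = A_i / C_k and the double sum over pairs of paths equals Σ_i A_i², and let
-- walks n a b count the n-step walks from altitude a to altitude b that stay ≥ 0.
-- Cutting a Dyck path of length 4k in the middle gives C_{2k} = Σ_j walks 2k 0 j · walks 2k j 0.
-- Odd j contribute nothing and j = 0 contributes C_k²; for j = 2i + 2 the reflection principle gives
-- walks 2k 0 j = walks 2k j 0 = C(2k, k+i+1) − C(2k, k+i+2), and a first-step recursion shows that
-- A_i has the same value. Hence Σ_i A_i² = C_{2k} − C_k², and dividing by C_k² gives both equalities.
module Submission where

open import Function using (_∘_)
open import Data.Bool using (true; false)
open import Data.Nat using (ℕ; zero; suc; _+_; _*_; _∸_; _<_; _≥_; _≟_; s≤s; z<s; NonZero)
open import Data.Nat.Properties
open import Data.Nat.ListAction using (sum)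
open import Data.Nat.Combinatorics using (_C_; nCk+nC[k+1]≡[n+1]C[k+1]; nCk≡nC[n∸k]; k>n⇒nCk≡0; nC1≡n)
open import Data.Nat.Tactic.RingSolver using (solve-∀)
import Data.Integer as ℤ
import Data.Integer.Properties as ℤ
open import Data.Rational using (ℚ; _-_; 1ℚ) renaming (_+_ to _+ℚ_; _*_ to _*ℚ_; _/_ to _/ℚ_)
open import Data.Rational.Base using (fromℚᵘ)
import Data.Rational.Properties as ℚ
open import Data.Rational.Unnormalised as ℚᵘ using (mkℚᵘ; *≡*)
import Data.Rational.Unnormalised.Properties as ℚᵘ
open import Data.Rational.Solver using (module +-*-Solver)
open import Data.List using (List; []; _∷_; map; filter; concatMap; applyUpTo; upTo)
open import Data.List.Properties using (map-cong; map-cong-local; map-upTo; foldr-cong)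
import Data.List.Relation.Unary.All as All
open import Data.List.Relation.Unary.All.Properties using (all-upTo)
open import Data.Vec using (Vec; []; _∷_)
open import Data.Product using (_×_; _,_)
open import Relation.Binary.PropositionalEquality
open import Relation.Nullary using (Dec; yes; no; contradiction)
open import Relation.Unary using (Pred; Decidable)
open import Algebra.Properties.CommutativeSemigroup +-commutativeSemigroup using (interchange; x∙yz≈y∙xz)
open import Defs

sum-map-+ : ∀ {a} {A : Set a} (f g : A → ℕ) xs →
            sum (map (λ x → f x + g x) xs) ≡ sum (map f xs) + sum (map g xs)
sum-map-+ f g []       = refl
sum-map-+ f g (x ∷ xs) = trans (cong (f x + g x +_) (sum-map-+ f g xs)) (interchange (f x) (g x) _ _)

sum-map-0 : ∀ {a} {A : Set a} (xs : List A) → sum (map (λ _ → 0) xs) ≡ 0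
sum-map-0 []       = refl
sum-map-0 (x ∷ xs) = sum-map-0 xs

sum-map-*ˡ : ∀ {a} {A : Set a} c (f : A → ℕ) xs → sum (map (λ x → c * f x) xs) ≡ c * sum (map f xs)
sum-map-*ˡ c f []       = sym (*-zeroʳ c)
sum-map-*ˡ c f (x ∷ xs) = trans (cong (c * f x +_) (sum-map-*ˡ c f xs)) (sym (*-distribˡ-+ c (f x) _))

sum-map-*ʳ : ∀ {a} {A : Set a} c (f : A → ℕ) xs → sum (map (λ x → f x * c) xs) ≡ sum (map f xs) * c
sum-map-*ʳ c f []       = refl
sum-map-*ʳ c f (x ∷ xs) = trans (cong (f x * c +_) (sum-map-*ʳ c f xs)) (sym (*-distribʳ-+ c (f x) _))

sum-map-swap : ∀ {a b} {A : Set a} {B : Set b} (f : A → B → ℕ) xs ys →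
               sum (map (λ x → sum (map (f x) ys)) xs) ≡ sum (map (λ y → sum (map (λ x → f x y) xs)) ys)
sum-map-swap f []       ys = sym (sum-map-0 ys)
sum-map-swap f (x ∷ xs) ys = trans (cong (sum (map (f x) ys) +_) (sum-map-swap f xs ys))
                                   (sym (sum-map-+ (f x) (λ y → sum (map (λ x → f x y) xs)) ys))

sum-map-*-sum-map : ∀ {a b} {A : Set a} {B : Set b} (f : A → ℕ) (g : B → ℕ) xs ys →
                    sum (map f xs) * sum (map g ys) ≡ sum (map (λ x → sum (map (λ y → f x * g y) ys)) xs)
sum-map-*-sum-map f g xs ys = trans (sym (sum-map-*ʳ (sum (map g ys)) f xs))
                                    (cong sum (map-cong (λ x → sym (sum-map-*ˡ (f x) g ys)) xs))

sum-pairs-dot : ∀ {a b} {A : Set a} {I : Set b} (f : I → A → ℕ) xs is →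
                sum (map (λ x → sum (map (λ y → sum (map (λ i → f i x * f i y) is)) xs)) xs)
                  ≡ sum (map (λ i → sum (map (f i) xs) * sum (map (f i) xs)) is)
sum-pairs-dot f xs is = begin
  sum (map (λ x → sum (map (λ y → sum (map (λ i → f i x * f i y) is)) xs)) xs)
    ≡⟨ cong sum (map-cong (λ x → sum-map-swap (λ y i → f i x * f i y) xs is) xs) ⟩
  sum (map (λ x → sum (map (λ i → sum (map (λ y → f i x * f i y) xs)) is)) xs)
    ≡⟨ sum-map-swap (λ x i → sum (map (λ y → f i x * f i y) xs)) xs is ⟩
  sum (map (λ i → sum (map (λ x → sum (map (λ y → f i x * f i y) xs)) xs)) is)
    ≡⟨ cong sum (map-cong (λ i → sum-map-*-sum-map (f i) (f i) xs xs) is) ⟨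
  sum (map (λ i → sum (map (f i) xs) * sum (map (f i) xs)) is)
    ∎
  where open ≡-Reasoning

𝟙 : ∀ {a} {A : Set a} → Dec A → ℕ
𝟙 (yes _) = 1
𝟙 (no _)  = 0

sum-map-filter : ∀ {a p} {A : Set a} {P : Pred A p} (P? : Decidable P) (f : A → ℕ) xs →
                 sum (map f (filter P? xs)) ≡ sum (map (λ x → 𝟙 (P? x) * f x) xs)
sum-map-filter P? f []       = refl
sum-map-filter P? f (x ∷ xs) with P? x
... | yes _ = cong₂ _+_ (sym (+-identityʳ (f x))) (sum-map-filter P? f xs)
... | no  _ = sum-map-filter P? f xs

sum-map-upTo-cong : ∀ {f g : ℕ → ℕ} n → (∀ {i} → i < n → f i ≡ g i) →
                    sum (map f (upTo n)) ≡ sum (map g (upTo n))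
sum-map-upTo-cong n f≡g = cong sum (map-cong-local (All.map f≡g (all-upTo n)))

sum-applyUpTo-pairs : ∀ k (g h : ℕ → ℕ) → (∀ i → h i ≡ g (2 * i) + g (suc (2 * i))) →
                      sum (applyUpTo g (2 * k)) ≡ sum (applyUpTo h k)
sum-applyUpTo-pairs zero    g h h≡ = refl
sum-applyUpTo-pairs (suc k) g h h≡ rewrite +-suc k (k + 0) = begin
  g 0 + (g 1 + sum (applyUpTo (g ∘ suc ∘ suc) (2 * k)))
    ≡⟨ +-assoc (g 0) (g 1) _ ⟨
  g 0 + g 1 + sum (applyUpTo (g ∘ suc ∘ suc) (2 * k))
    ≡⟨ cong₂ _+_ (sym (h≡ 0)) (sum-applyUpTo-pairs k (g ∘ suc ∘ suc) (h ∘ suc) h∘suc≡) ⟩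
  h 0 + sum (applyUpTo (h ∘ suc) k)
    ∎
  where
  open ≡-Reasoning
  h∘suc≡ : ∀ i → h (suc i) ≡ g (suc (suc (2 * i))) + g (suc (suc (suc (2 * i))))
  h∘suc≡ i = trans (h≡ (suc i)) (cong (λ j → g j + g (suc j)) (cong suc (+-suc i (i + 0))))

-- Nonnegative walks

δ : ℕ → ℕ → ℕ
δ zero    zero    = 1
δ zero    (suc b) = 0
δ (suc a) zero    = 0
δ (suc a) (suc b) = δ a b

δ-refl : ∀ a → δ a a ≡ 1
δ-refl zero    = refl
δ-refl (suc a) = δ-refl a

δ-≢ : ∀ {a b} → a ≢ b → δ a b ≡ 0
δ-≢ {zero}  {zero}  a≢b = contradiction refl a≢b
δ-≢ {zero}  {suc b} _   = refl
δ-≢ {suc a} {zero}  _   = refl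
δ-≢ {suc a} {suc b} a≢b = δ-≢ (a≢b ∘ cong suc)

sum-upTo-δ : ∀ a L (g : ℕ → ℕ) → a < L → sum (map (λ j → δ a j * g j) (upTo L)) ≡ g a
sum-upTo-δ a L g a<L = trans (cong sum (map-upTo _ L)) (go a L g a<L)
  where
  go : ∀ a L (g : ℕ → ℕ) → a < L → sum (applyUpTo (λ j → δ a j * g j) L) ≡ g a
  go zero    (suc L) g _         = trans (cong₂ _+_ (+-identityʳ (g 0)) zeros) (+-identityʳ (g 0))
    where
    zeros : sum (applyUpTo (λ _ → 0) L) ≡ 0
    zeros = trans (sym (cong sum (map-upTo (λ _ → 0) L))) (sum-map-0 (upTo L))
  go (suc a) (suc L) g (s≤s a<L) = go a L (g ∘ suc) a<L

walks : ℕ → ℕ → ℕ → ℕ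
walks zero    a       b = δ a b
walks (suc n) zero    b = walks n 1 b
walks (suc n) (suc a) b = walks n (suc (suc a)) b + walks n a b

walks-beyond : ∀ n a b → n + a < b → walks n a b ≡ 0
walks-beyond zero    a       b n+a<b = δ-≢ (<⇒≢ n+a<b)
walks-beyond (suc n) zero    b n+a<b = walks-beyond n 1 b (subst (_< b) (sym (+-suc n 0)) n+a<b)
walks-beyond (suc n) (suc a) b n+a<b = cong₂ _+_
  (walks-beyond n (suc (suc a)) b (subst (_< b) (sym (+-suc n (suc a))) n+a<b))
  (walks-beyond n a b (<-trans (s≤s (+-monoʳ-≤ n (n≤1+n a))) n+a<b))

walks-all-rises : ∀ n a b → n + a ≡ b → walks n a b ≡ 1
walks-all-rises zero    a       b refl  = δ-refl a
walks-all-rises (suc n) zero    b n+a≡b = walks-all-rises n 1 b (trans (+-suc n 0) n+a≡b)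
walks-all-rises (suc n) (suc a) b n+a≡b = cong₂ _+_
  (walks-all-rises n (suc (suc a)) b (trans (+-suc n (suc a)) n+a≡b))
  (walks-beyond n a b (subst (n + a <_) n+a≡b (s≤s (+-monoʳ-≤ n (n≤1+n a)))))

cancel-suc-suc : ∀ {b r m a} → b + suc r + suc r ≡ suc m + suc a → b + r + r ≡ m + a
cancel-suc-suc {b} {r} {m} {a} eq = suc-injective (suc-injective (begin
  suc (suc (b + r + r)) ≡⟨ cong (λ x → suc (x + r)) (+-suc b r) ⟨
  suc (b + suc r + r)   ≡⟨ +-suc (b + suc r) r ⟨
  b + suc r + suc r     ≡⟨ eq ⟩
  suc (m + suc a)       ≡⟨ cong suc (+-suc m a) ⟩
  suc (suc (m + a))     ∎))
  where open ≡-Reasoning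

walks-odd : ∀ n a b r → suc (b + r + r) ≡ n + a → walks n a b ≡ 0
walks-odd zero    a       b r eq = δ-≢ (>⇒≢ (subst (b <_) eq (s≤s (≤-trans (m≤m+n b r) (m≤m+n (b + r) r)))))
walks-odd (suc n) zero    b r eq = walks-odd n 1 b r (trans eq (sym (+-suc n 0)))
walks-odd (suc n) (suc a) b r eq =
  cong₂ _+_ (walks-odd n (suc (suc a)) b r (trans eq (sym (+-suc n (suc a))))) (walks-odd-below r eq)
  where
  walks-odd-below : ∀ r → suc (b + r + r) ≡ suc n + suc a → walks n a b ≡ 0
  walks-odd-below zero    eq = walks-beyond n a b (≤-reflexive (begin
    suc (n + a) ≡⟨ +-suc n a ⟨
    n + suc a   ≡⟨ suc-injective eq ⟨
    b + 0 + 0   ≡⟨ +-identityʳ (b + 0) ⟩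
    b + 0       ≡⟨ +-identityʳ b ⟩
    b           ∎))
    where open ≡-Reasoning
  walks-odd-below (suc r) eq = walks-odd n a b r (cancel-suc-suc {suc b} eq)

walks-+ : ∀ m n a b L → a + m < L →
          walks (m + n) a b ≡ sum (map (λ j → walks m a j * walks n j b) (upTo L))
walks-+ zero    n a       b L a+m<L =
  sym (sum-upTo-δ a L (λ j → walks n j b) (subst (_< L) (+-identityʳ a) a+m<L))
walks-+ (suc m) n zero    b L a+m<L = walks-+ m n 1 b L a+m<L
walks-+ (suc m) n (suc a) b L a+m<L = begin
  walks (m + n) (suc (suc a)) b + walks (m + n) a b
    ≡⟨ cong₂ _+_ (walks-+ m n (suc (suc a)) b L (subst (_< L) (cong suc (+-suc a m)) a+m<L))
                 (walks-+ m n a b L (<-trans (s≤s (+-monoʳ-≤ a (n≤1+n m))) a+m<L)) ⟩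
  sum (map (λ j → up j * on j) (upTo L)) + sum (map (λ j → down j * on j) (upTo L))
    ≡⟨ sum-map-+ (λ j → up j * on j) (λ j → down j * on j) (upTo L) ⟨
  sum (map (λ j → up j * on j + down j * on j) (upTo L))
    ≡⟨ cong sum (map-cong (λ j → sym (*-distribʳ-+ (on j) (up j) (down j))) (upTo L)) ⟩
  sum (map (λ j → walks (suc m) (suc a) j * walks n j b) (upTo L))
    ∎
  where
  open ≡-Reasoning
  up down on : ℕ → ℕ
  up j = walks m (suc (suc a)) j
  down j = walks m a j
  on j = walks n j b

pascal : ∀ n k → suc n C suc k ≡ n C k + n C suc k
pascal n k = sym (nCk+nC[k+1]≡[n+1]C[k+1] n k)

C-sym : ∀ x y → (x + y) C x ≡ (x + y) C y
C-sym x y = trans (nCk≡nC[n∸k] (m≤m+n x y)) (cong ((x + y) C_) (m+n∸m≡n x y))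

[k+1]*nC[k+1]+k*nCk≡n*nCk : ∀ n k → suc k * (n C suc k) + k * (n C k) ≡ n * (n C k)
[k+1]*nC[k+1]+k*nCk≡n*nCk zero    zero    = refl
[k+1]*nC[k+1]+k*nCk≡n*nCk zero    (suc k) = cong₂ _+_ (*-zeroʳ (suc (suc k))) (*-zeroʳ (suc k))
[k+1]*nC[k+1]+k*nCk≡n*nCk (suc m) zero    = trans (cong (λ x → 1 * x + 0) (nC1≡n (suc m))) (eq m)
  where
  eq : ∀ m → 1 * suc m + 0 ≡ suc m * 1
  eq = solve-∀
[k+1]*nC[k+1]+k*nCk≡n*nCk (suc m) (suc k) = begin
  suc (suc k) * (suc m C suc (suc k)) + suc k * (suc m C suc k)
    ≡⟨ cong₂ (λ u v → suc (suc k) * u + suc k * v) (pascal m (suc k)) (pascal m k) ⟩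
  suc (suc k) * (y + z) + suc k * (x + y)
    ≡⟨ regroup k x y z ⟩
  (suc (suc k) * z + suc k * y) + (suc k * y + k * x) + y + x
    ≡⟨ cong₂ (λ u v → u + v + y + x) ([k+1]*nC[k+1]+k*nCk≡n*nCk m (suc k))
                                     ([k+1]*nC[k+1]+k*nCk≡n*nCk m k) ⟩
  m * y + m * x + y + x
    ≡⟨ collect m x y ⟩
  suc m * (x + y)
    ≡⟨ cong (suc m *_) (pascal m k) ⟨
  suc m * (suc m C suc k)
    ∎
  where
  open ≡-Reasoning
  x = m C k
  y = m C suc k
  z = m C suc (suc k)
  regroup : ∀ k x y z → suc (suc k) * (y + z) + suc k * (x + y)
                          ≡ (suc (suc k) * z + suc k * y) + (suc k * y + k * x) + y + x
  regroup = solve-∀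
  collect : ∀ m x y → m * y + m * x + y + x ≡ suc m * (x + y)
  collect = solve-∀

-- Reflection principle, r being the number of falls: walks n a b = C(n, r) − C(n, r + b + 1).
walks-binomial : ∀ n a b r → b + r + r ≡ n + a → walks n a b + n C suc (b + r) ≡ n C r
walks-binomial n a b zero eq = cong₂ _+_
  (walks-all-rises n a b (sym (trans (sym (+-identityʳ b)) b+0≡n+a)))
  (k>n⇒nCk≡0 (s≤s (≤-trans (m≤m+n n a) (≤-reflexive (sym b+0≡n+a)))))
  where
  b+0≡n+a : b + 0 ≡ n + a
  b+0≡n+a = trans (sym (+-identityʳ (b + 0))) eq
walks-binomial zero a b (suc r) eq = trans (+-identityʳ (δ a b))
  (δ-≢ (>⇒≢ (subst (b <_) eq (≤-trans (m<m+n b z<s) (m≤m+n (b + suc r) (suc r))))))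
walks-binomial (suc m) zero b (suc r) eq = begin
  walks m 1 b + suc m C suc (b + suc r)
    ≡⟨ cong (walks m 1 b +_) (pascal m (b + suc r)) ⟩
  walks m 1 b + (m C (b + suc r) + m C suc (b + suc r))
    ≡⟨ x∙yz≈y∙xz (walks m 1 b) (m C (b + suc r)) (m C suc (b + suc r)) ⟩
  m C (b + suc r) + (walks m 1 b + m C suc (b + suc r))
    ≡⟨ cong₂ _+_ mirror (walks-binomial m 1 b (suc r) (trans eq (sym (+-suc m 0)))) ⟩
  m C r + m C suc r
    ≡⟨ pascal m r ⟨
  suc m C suc r
    ∎
  where
  open ≡-Reasoning
  b+1+r+r≡m : b + suc r + r ≡ m
  b+1+r+r≡m = trans (suc-injective (trans (sym (+-suc (b + suc r) r)) eq)) (+-identityʳ m)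
  mirror : m C (b + suc r) ≡ m C r
  mirror = subst (λ n → n C (b + suc r) ≡ n C r) b+1+r+r≡m (C-sym (b + suc r) r)
walks-binomial (suc m) (suc a) b (suc r) eq = begin
  walks m (suc (suc a)) b + walks m a b + suc m C suc (b + suc r)
    ≡⟨ cong₂ _+_ (+-comm (walks m (suc (suc a)) b) (walks m a b)) (pascal m (b + suc r)) ⟩
  walks m a b + walks m (suc (suc a)) b + (m C (b + suc r) + m C suc (b + suc r))
    ≡⟨ interchange (walks m a b) _ _ _ ⟩
  (walks m a b + m C (b + suc r)) + (walks m (suc (suc a)) b + m C suc (b + suc r))
    ≡⟨ cong₂ _+_ (trans (cong (λ x → walks m a b + m C x) (+-suc b r))
                        (walks-binomial m a b r (cancel-suc-suc eq)))
                 (walks-binomial m (suc (suc a)) b (suc r) (trans eq (sym (+-suc m (suc a))))) ⟩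
  m C r + m C suc r
    ≡⟨ pascal m r ⟨
  suc m C suc r
    ∎
  where open ≡-Reasoning

[1+m]*walks≡[2m]Cm : ∀ m → suc m * walks (2 * m) 0 0 ≡ (2 * m) C m
[1+m]*walks≡[2m]Cm m = +-cancelʳ-≡ (2 * m * Y) (suc m * W) Y (begin
  suc m * W + 2 * m * Y           ≡⟨ cong (suc m * W +_) ([k+1]*nC[k+1]+k*nCk≡n*nCk (2 * m) m) ⟨
  suc m * W + (suc m * X + m * Y) ≡⟨ regroup (suc m) W X (m * Y) ⟩
  suc m * (W + X) + m * Y         ≡⟨ cong (λ u → suc m * u + m * Y) (walks-binomial (2 * m) 0 0 m (m+m≡2m+0 m)) ⟩
  suc m * Y + m * Y               ≡⟨ collect m Y ⟩
  Y + 2 * m * Y                   ∎)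
  where
  open ≡-Reasoning
  W = walks (2 * m) 0 0
  X = (2 * m) C suc m
  Y = (2 * m) C m
  m+m≡2m+0 : ∀ m → m + m ≡ 2 * m + 0
  m+m≡2m+0 = solve-∀
  regroup : ∀ s w x y → s * w + (s * x + y) ≡ s * (w + x) + y
  regroup = solve-∀
  collect : ∀ m y → suc m * y + m * y ≡ y + 2 * m * y
  collect = solve-∀

-- rises n h i: the rises from altitude i to i + 1, summed over the walks counted by walks n h 0.
rises : ℕ → ℕ → ℕ → ℕ
rises zero    h       i = 0
rises (suc n) zero    i = δ i 0 * walks n 1 0 + rises n 1 i
rises (suc n) (suc h) i = (δ i (suc h) * walks n (suc (suc h)) 0 + rises n (suc (suc h)) i) + rises n h i

-- The comparison of the counted level i with the current altitude j in rises-binomial: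
-- there c t is m C (t + s), and w counts the walks that start with a rise from j.
level-crossing : ∀ (c : ℕ → ℕ) w i j → w + c 1 ≡ c 0 →
                 δ i j * w + c (suc (i ∸ suc j)) + c (suc i ∸ j) ≡ c (i ∸ j) + c (suc (i ∸ j))
level-crossing c w zero    zero    eq = cong (_+ c 1) (trans (cong (_+ c 1) (+-identityʳ w)) eq)
level-crossing c w (suc i) zero    eq = refl
level-crossing c w zero    (suc j) eq = trans (cong (λ t → c 1 + c t) (0∸n≡0 j)) (+-comm (c 1) (c 0))
level-crossing c w (suc i) (suc j) eq = level-crossing c w i j eq

-- As in walks-binomial, s is the number of falls.
rises-binomial : ∀ n h i s → s + s ≡ n + h → rises n h i + n C (suc (suc i) + s) ≡ n C (suc (i ∸ h) + s)
rises-binomial zero    h       i s       eq = refl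
rises-binomial (suc m) zero    i (suc s) eq = begin
  δ i 0 * w + rises m 1 i + suc m C (suc (suc i) + s')
    ≡⟨ cong (δ i 0 * w + rises m 1 i +_) (pascal m (suc (i + s'))) ⟩
  δ i 0 * w + rises m 1 i + (c (suc i) + c (suc (suc i)))
    ≡⟨ shuffle (δ i 0 * w) (rises m 1 i) (c (suc i)) (c (suc (suc i))) ⟩
  δ i 0 * w + (rises m 1 i + c (suc (suc i))) + c (suc i)
    ≡⟨ cong (λ x → δ i 0 * w + x + c (suc i)) (rises-binomial m 1 i s' eq′) ⟩
  δ i 0 * w + c (suc (i ∸ 1)) + c (suc i)
    ≡⟨ level-crossing c w i 0 (walks-binomial m 1 0 s' eq′) ⟩
  c i + c (suc i)
    ≡⟨ pascal m (i + s') ⟨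
  suc m C (suc i + s')
    ∎
  where
  open ≡-Reasoning
  s' = suc s
  w = walks m 1 0
  c : ℕ → ℕ
  c t = m C (t + s')
  eq′ : s' + s' ≡ m + 1
  eq′ = trans eq (sym (+-suc m 0))
  shuffle : ∀ x y u v → x + y + (u + v) ≡ x + (y + v) + u
  shuffle = solve-∀
rises-binomial (suc m) (suc h) i (suc s) eq = begin
  δ i (suc h) * w + rises m (suc (suc h)) i + rises m h i + suc m C (suc (suc i) + s')
    ≡⟨ cong (δ i (suc h) * w + rises m (suc (suc h)) i + rises m h i +_) (pascal m (suc (i + s'))) ⟩
  δ i (suc h) * w + rises m (suc (suc h)) i + rises m h i + (c (suc i) + c (suc (suc i)))
    ≡⟨ shuffle (δ i (suc h) * w) (rises m (suc (suc h)) i) (rises m h i) (c (suc i)) (c (suc (suc i))) ⟩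
  δ i (suc h) * w + (rises m (suc (suc h)) i + c (suc (suc i))) + (rises m h i + c (suc i))
    ≡⟨ cong₂ (λ x y → δ i (suc h) * w + x + y) (rises-binomial m (suc (suc h)) i s' eq′) below ⟩
  δ i (suc h) * w + c (suc (i ∸ suc (suc h))) + c (i ∸ h)
    ≡⟨ level-crossing c w i (suc h) (walks-binomial m (suc (suc h)) 0 s' eq′) ⟩
  c (i ∸ suc h) + c (suc (i ∸ suc h))
    ≡⟨ pascal m (i ∸ suc h + s') ⟨
  suc m C (suc (i ∸ suc h) + s')
    ∎
  where
  open ≡-Reasoning
  s' = suc s
  w = walks m (suc (suc h)) 0
  c : ℕ → ℕ
  c t = m C (t + s')
  eq′ : s' + s' ≡ m + suc (suc h)
  eq′ = trans eq (sym (+-suc m (suc h)))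
  below : rises m h i + c (suc i) ≡ c (i ∸ h)
  below = begin
    rises m h i + m C suc (i + suc s)   ≡⟨ cong (λ x → rises m h i + m C suc x) (+-suc i s) ⟩
    rises m h i + m C (suc (suc i) + s) ≡⟨ rises-binomial m h i s (cancel-suc-suc {0} eq) ⟩
    m C (suc (i ∸ h) + s)               ≡⟨ cong (m C_) (+-suc (i ∸ h) s) ⟨
    c (i ∸ h)                           ∎
  shuffle : ∀ x y z u v → x + y + z + (u + v) ≡ x + (y + v) + (z + u)
  shuffle = solve-∀

rises-binomial-Dyck : ∀ k i → rises (2 * k) 0 i + (2 * k) C (suc (suc i) + k) ≡ (2 * k) C (suc i + k)
rises-binomial-Dyck k i = rises-binomial (2 * k) 0 i k (k+k≡2k+0 k)
  where
  k+k≡2k+0 : ∀ k → k + k ≡ 2 * k + 0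
  k+k≡2k+0 = solve-∀

rises≡walks-from : ∀ k i → rises (2 * k) 0 i ≡ walks (2 * k) (suc (suc (2 * i))) 0
rises≡walks-from k i = +-cancelʳ-≡ _ _ _ (trans (rises-binomial-Dyck k i) (sym binomial-form))
  where
  binomial-form : walks (2 * k) (suc (suc (2 * i))) 0 + (2 * k) C (suc (suc i) + k) ≡ (2 * k) C (suc i + k)
  binomial-form = walks-binomial (2 * k) (suc (suc (2 * i))) 0 (suc i + k) (eq i k)
    where
    eq : ∀ i k → suc i + k + (suc i + k) ≡ 2 * k + suc (suc (2 * i))
    eq = solve-∀

rises≡walks-to : ∀ {k i} → i < k → rises (2 * k) 0 i ≡ walks (2 * k) 0 (suc (suc (2 * i)))
rises≡walks-to {k} {i} i<k = +-cancelʳ-≡ _ _ _ (trans (rises-binomial-Dyck k i) (sym binomial-form))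
  where
  binomial-form : walks (2 * k) 0 (suc (suc (2 * i))) + (2 * k) C (suc (suc i) + k) ≡ (2 * k) C (suc i + k)
  binomial-form with (d , refl) ← m≤n⇒∃[o]m+o≡n i<k = begin
    walks n 0 t + n C (suc (suc i) + k) ≡⟨ cong (λ x → walks n 0 t + n C x) (eq₁ i d) ⟨
    walks n 0 t + n C suc (t + d)       ≡⟨ walks-binomial n 0 t d (eq₂ i d) ⟩
    n C d                               ≡⟨ subst (λ m → m C d ≡ m C (suc i + k)) (eq₃ i d) (C-sym d (suc i + k)) ⟩
    n C (suc i + k)                     ∎
    where
    open ≡-Reasoning
    n = 2 * k
    t = suc (suc (2 * i))
    eq₁ : ∀ i d → suc (suc (suc (2 * i)) + d) ≡ suc (suc i) + suc (i + d)
    eq₁ = solve-∀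
    eq₂ : ∀ i d → suc (suc (2 * i)) + d + d ≡ 2 * suc (i + d) + 0
    eq₂ = solve-∀
    eq₃ : ∀ i d → d + (suc i + suc (i + d)) ≡ 2 * suc (i + d)
    eq₃ = solve-∀

walks-to-odd : ∀ {k i} → i < k → walks (2 * k) 0 (suc (2 * i)) ≡ 0
walks-to-odd {k} {i} i<k with (d , refl) ← m≤n⇒∃[o]m+o≡n i<k =
  walks-odd (2 * k) 0 (suc (2 * i)) d (eq i d)
  where
  eq : ∀ i d → suc (suc (2 * i) + d + d) ≡ 2 * suc (i + d) + 0
  eq = solve-∀

sumRises² : ℕ → ℕ
sumRises² k = sum (map (λ i → rises (2 * k) 0 i * rises (2 * k) 0 i) (upTo k))

sumRises²+walks²≡walks : ∀ k → sumRises² k + walks (2 * k) 0 0 * walks (2 * k) 0 0 ≡ walks (2 * (2 * k)) 0 0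
sumRises²+walks²≡walks k = begin
  sumRises² k + f 0                ≡⟨ +-comm (sumRises² k) (f 0) ⟩
  f 0 + sumRises² k                ≡⟨ cong (f 0 +_) (sum-map-upTo-cong k pair≡rises²) ⟨
  f 0 + sum (map pair (upTo k))    ≡⟨ cong (f 0 +_) (cong sum (map-upTo pair k)) ⟩
  f 0 + sum (applyUpTo pair k)     ≡⟨ cong (f 0 +_) (sum-applyUpTo-pairs k (f ∘ suc) pair (λ _ → refl)) ⟨
  sum (applyUpTo f (suc n))        ≡⟨ cong sum (map-upTo f (suc n)) ⟨
  sum (map f (upTo (suc n)))       ≡⟨ walks-+ n n 0 0 (suc n) (n<1+n n) ⟨
  walks (n + n) 0 0                ≡⟨ cong (λ m → walks m 0 0) (cong (n +_) (+-identityʳ n)) ⟨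
  walks (2 * n) 0 0                ∎
  where
  open ≡-Reasoning
  n = 2 * k
  f : ℕ → ℕ
  f j = walks n 0 j * walks n j 0
  pair : ℕ → ℕ
  pair i = f (suc (2 * i)) + f (suc (suc (2 * i)))
  pair≡rises² : ∀ {i} → i < k → pair i ≡ rises n 0 i * rises n 0 i
  pair≡rises² {i} i<k = cong₂ _+_ (cong (_* walks n (suc (2 * i)) 0) (walks-to-odd i<k))
                                  (sym (cong₂ _*_ (rises≡walks-to i<k) (rises≡walks-from k i)))

-- Dyck words

sum-map-allWords : ∀ n (g : Vec Step (suc n) → ℕ) →
                   sum (map g (allWords (suc n))) ≡ sum (map (λ w → g (true ∷ w) + g (false ∷ w)) (allWords n))
sum-map-allWords n g = go (allWords n)
  where
  go : ∀ ws → sum (map g (concatMap (λ w → (true ∷ w) ∷ (false ∷ w) ∷ []) ws))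
                ≡ sum (map (λ w → g (true ∷ w) + g (false ∷ w)) ws)
  go []       = refl
  go (w ∷ ws) = trans (sym (+-assoc (g (true ∷ w)) (g (false ∷ w)) _))
                      (cong (g (true ∷ w) + g (false ∷ w) +_) (go ws))

dyckSum : ∀ n → ℕ → (Vec Step n → ℕ) → ℕ
dyckSum n h f = sum (map (λ w → 𝟙 (dyckFrom? h w) * f w) (allWords n))

dyckSum-cong : ∀ n h {f g : Vec Step n → ℕ} → (∀ w → f w ≡ g w) → dyckSum n h f ≡ dyckSum n h g
dyckSum-cong n h f≡g = cong sum (map-cong (λ w → cong (𝟙 (dyckFrom? h w) *_) (f≡g w)) (allWords n))

dyckSum-+ : ∀ n h (f g : Vec Step n → ℕ) → dyckSum n h (λ w → f w + g w) ≡ dyckSum n h f + dyckSum n h g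
dyckSum-+ n h f g = trans (cong sum (map-cong (λ w → *-distribˡ-+ (𝟙 (dyckFrom? h w)) (f w) (g w)) (allWords n)))
                          (sum-map-+ _ _ (allWords n))

dyckSum-rise : ∀ n (f : Vec Step (suc n) → ℕ) → dyckSum (suc n) 0 f ≡ dyckSum n 1 (f ∘ (true ∷_))
dyckSum-rise n f = trans (sum-map-allWords n _) (cong sum (map-cong (λ w → +-identityʳ _) (allWords n)))

dyckSum-step : ∀ n h (f : Vec Step (suc n) → ℕ) →
               dyckSum (suc n) (suc h) f ≡ dyckSum n (suc (suc h)) (f ∘ (true ∷_)) + dyckSum n h (f ∘ (false ∷_))
dyckSum-step n h f = trans (sum-map-allWords n _) (sum-map-+ _ _ (allWords n))

dyckSum-const : ∀ n h c → dyckSum n h (λ _ → c) ≡ c * walks n h 0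
dyckSum-const zero    zero    c = trans (+-identityʳ (1 * c)) (trans (*-identityˡ c) (sym (*-identityʳ c)))
dyckSum-const zero    (suc h) c = sym (*-zeroʳ c)
dyckSum-const (suc n) zero    c = trans (dyckSum-rise n (λ _ → c)) (dyckSum-const n 1 c)
dyckSum-const (suc n) (suc h) c = trans (dyckSum-step n h (λ _ → c))
  (trans (cong₂ _+_ (dyckSum-const n (suc (suc h)) c) (dyckSum-const n h c))
         (sym (*-distribˡ-+ c (walks n (suc (suc h)) 0) (walks n h 0))))

risesFrom-rise : ∀ i h {n} (w : Vec Step n) → risesFrom i h (true ∷ w) ≡ δ i h + risesFrom i (suc h) w
risesFrom-rise i h w with i ≟ h
... | yes refl = cong (_+ risesFrom i (suc i) w) (sym (δ-refl i))
... | no  i≢h  = cong (_+ risesFrom i (suc h) w) (sym (δ-≢ i≢h))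

dyckSum-risesFrom : ∀ n h i → dyckSum n h (risesFrom i h) ≡ rises n h i
dyckSum-risesFrom-rise : ∀ n h i →
  dyckSum n (suc h) (λ w → risesFrom i h (true ∷ w)) ≡ δ i h * walks n (suc h) 0 + rises n (suc h) i

dyckSum-risesFrom zero    h       i = cong (_+ 0) (*-zeroʳ (𝟙 (dyckFrom? h [])))
dyckSum-risesFrom (suc n) zero    i = trans (dyckSum-rise n (risesFrom i 0)) (dyckSum-risesFrom-rise n 0 i)
dyckSum-risesFrom (suc n) (suc h) i = trans (dyckSum-step n h (risesFrom i (suc h)))
  (cong₂ _+_ (dyckSum-risesFrom-rise n (suc h) i) (dyckSum-risesFrom n h i))

dyckSum-risesFrom-rise n h i = begin
  dyckSum n (suc h) (λ w → risesFrom i h (true ∷ w))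
    ≡⟨ dyckSum-cong n (suc h) (risesFrom-rise i h) ⟩
  dyckSum n (suc h) (λ w → δ i h + risesFrom i (suc h) w)
    ≡⟨ dyckSum-+ n (suc h) (λ _ → δ i h) (risesFrom i (suc h)) ⟩
  dyckSum n (suc h) (λ _ → δ i h) + dyckSum n (suc h) (risesFrom i (suc h))
    ≡⟨ cong₂ _+_ (dyckSum-const n (suc h) (δ i h)) (dyckSum-risesFrom n (suc h) i) ⟩
  δ i h * walks n (suc h) 0 + rises n (suc h) i
    ∎
  where open ≡-Reasoning

sum-R≡rises : ∀ k i → sum (map (R i) (𝒟 k)) ≡ rises (2 * k) 0 i
sum-R≡rises k i = trans (sum-map-filter (dyckFrom? 0) (R i) (allWords (2 * k))) (dyckSum-risesFrom (2 * k) 0 i)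

sum-pairs-R≡sumRises² : ∀ k →
  sum (map (λ p₁ → sum (map (λ p₂ → sum (map (λ i → R i p₁ * R i p₂) (upTo k))) (𝒟 k))) (𝒟 k)) ≡ sumRises² k
sum-pairs-R≡sumRises² k = trans (sum-pairs-dot (λ i → R i) (𝒟 k) (upTo k))
  (cong sum (map-cong (λ i → cong₂ _*_ (sum-R≡rises k i) (sum-R≡rises k i)) (upTo k)))

fromℚᵘ-homo-+ : ∀ p q → fromℚᵘ (p ℚᵘ.+ q) ≡ fromℚᵘ p +ℚ fromℚᵘ q
fromℚᵘ-homo-+ p q = ℚ.toℚᵘ-injective (ℚᵘ.≃-trans (ℚ.toℚᵘ-fromℚᵘ (p ℚᵘ.+ q))
  (ℚᵘ.≃-sym (ℚᵘ.≃-trans (ℚ.toℚᵘ-homo-+ (fromℚᵘ p) (fromℚᵘ q))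
                        (ℚᵘ.+-cong (ℚ.toℚᵘ-fromℚᵘ p) (ℚ.toℚᵘ-fromℚᵘ q)))))

fromℚᵘ-homo-* : ∀ p q → fromℚᵘ (p ℚᵘ.* q) ≡ fromℚᵘ p *ℚ fromℚᵘ q
fromℚᵘ-homo-* p q = ℚ.toℚᵘ-injective (ℚᵘ.≃-trans (ℚ.toℚᵘ-fromℚᵘ (p ℚᵘ.* q))
  (ℚᵘ.≃-sym (ℚᵘ.≃-trans (ℚ.toℚᵘ-homo-* (fromℚᵘ p) (fromℚᵘ q))
                        (ℚᵘ.*-cong (ℚ.toℚᵘ-fromℚᵘ p) (ℚ.toℚᵘ-fromℚᵘ q)))))

+/*+/≡+/ : ∀ a b c d .{{_ : NonZero b}} .{{_ : NonZero d}} →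
           (ℤ.+ a /ℚ b) *ℚ (ℤ.+ c /ℚ d) ≡ (ℤ.+ (a * c) /ℚ (b * d)) {{m*n≢0 b d}}
+/*+/≡+/ a (suc b) c (suc d) =
  trans (sym (fromℚᵘ-homo-* (mkℚᵘ (ℤ.+ a) b) (mkℚᵘ (ℤ.+ c) d))) (ℚ./-cong (sym (ℤ.pos-* a c)) refl)

+/≡+/ : ∀ a b c d .{{_ : NonZero b}} .{{_ : NonZero d}} → a * d ≡ c * b → ℤ.+ a /ℚ b ≡ ℤ.+ c /ℚ d
+/≡+/ a (suc b) c (suc d) ad≡cb = ℚ.fromℚᵘ-cong {mkℚᵘ (ℤ.+ a) b} {mkℚᵘ (ℤ.+ c) d}
  (*≡* (trans (sym (ℤ.pos-* a (suc d))) (trans (cong ℤ.+_ ad≡cb) (ℤ.pos-* c (suc b)))))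

ι : ℕ → ℚ
ι n = ℤ.+ n /ℚ 1

ι-* : ∀ m n → ι (m * n) ≡ ι m *ℚ ι n
ι-* m n = sym (+/*+/≡+/ m 1 n 1)

ι-+ : ∀ m n → ι (m + n) ≡ ι m +ℚ ι n
ι-+ m n = trans (ℚ./-cong numerator refl) (fromℚᵘ-homo-+ (mkℚᵘ (ℤ.+ m) 0) (mkℚᵘ (ℤ.+ n) 0))
  where
  numerator : ℤ.+ (m + n) ≡ ℤ.+ m ℤ.* ℤ.+ 1 ℤ.+ ℤ.+ n ℤ.* ℤ.+ 1
  numerator = trans (ℤ.pos-+ m n) (sym (cong₂ ℤ._+_ (ℤ.*-identityʳ (ℤ.+ m)) (ℤ.*-identityʳ (ℤ.+ n))))

Σ[]-cong : ∀ {A : Set} {f g : A → ℚ} xs → (∀ x → f x ≡ g x) → Σ[ xs ] f ≡ Σ[ xs ] g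
Σ[]-cong xs f≡g = foldr-cong (λ x q → cong (_+ℚ q) (f≡g x)) refl xs

Σ[]-ι : ∀ {A : Set} xs {g : A → ℚ} (f : A → ℕ) → (∀ x → g x ≡ ι (f x)) → Σ[ xs ] g ≡ ι (sum (map f xs))
Σ[]-ι []       f g≡ιf = refl
Σ[]-ι (x ∷ xs) f g≡ιf = trans (cong₂ _+ℚ_ (g≡ιf x) (Σ[]-ι xs f g≡ιf)) (sym (ι-+ (f x) (sum (map f xs))))

Σ[]-*ˡ : ∀ {A : Set} c (g : A → ℚ) xs → Σ[ xs ] (λ x → c *ℚ g x) ≡ c *ℚ Σ[ xs ] g
Σ[]-*ˡ c g []       = sym (ℚ.*-zeroʳ c)
Σ[]-*ˡ c g (x ∷ xs) = trans (cong (c *ℚ g x +ℚ_) (Σ[]-*ˡ c g xs)) (sym (ℚ.*-distribˡ-+ c (g x) (Σ[ xs ] g)))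

invCatalan : ℕ → ℚ
invCatalan k = ((ℤ.+ suc k) /ℚ central k) {{central-nonZero k}}

invCatalan*invCatalan≡invCatalan² : ∀ k → invCatalan k *ℚ invCatalan k ≡ invCatalan² k
invCatalan*invCatalan≡invCatalan² k =
  +/*+/≡+/ (suc k) (central k) (suc k) (central k) {{central-nonZero k}} {{central-nonZero k}}

invCatalan²*walks²≡1 : ∀ k → invCatalan² k *ℚ ι (walks (2 * k) 0 0 * walks (2 * k) 0 0) ≡ 1ℚ
invCatalan²*walks²≡1 k = trans
  (+/*+/≡+/ (suc k * suc k) (central k * central k) (K * K) 1 {{central²-nonZero k}})
  (+/≡+/ (suc k * suc k * (K * K)) (central k * central k * 1) 1 1
         {{m*n≢0 (central k * central k) 1 {{central²-nonZero k}}}}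
         (trans (regroup (suc k) K) (cong (λ c → 1 * (c * c * 1)) ([1+m]*walks≡[2m]Cm k))))
  where
  K = walks (2 * k) 0 0
  regroup : ∀ s K → s * s * (K * K) * 1 ≡ 1 * (s * K * (s * K) * 1)
  regroup = solve-∀

ι-walks≡catalanℚ : ∀ m → ι (walks (2 * m) 0 0) ≡ catalanℚ m
ι-walks≡catalanℚ m = +/≡+/ (walks (2 * m) 0 0) 1 ((2 * m) C m) (suc m)
  (trans (*-comm (walks (2 * m) 0 0) (suc m)) (trans ([1+m]*walks≡[2m]Cm m) (sym (*-identityʳ ((2 * m) C m)))))

E-R : ∀ k i → E k (R i) ≡ invCatalan k *ℚ ι (rises (2 * k) 0 i)
E-R k i = cong (invCatalan k *ℚ_) (trans (Σ[]-ι (𝒟 k) (R i) (λ _ → refl)) (cong ι (sum-R≡rises k i)))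

normSqER≡invCatalan²*ι-sumRises² : ∀ k → normSqER k ≡ invCatalan² k *ℚ ι (sumRises² k)
normSqER≡invCatalan²*ι-sumRises² k = begin
  Σ[ upTo k ] (λ i → E k (R i) *ℚ E k (R i))        ≡⟨ Σ[]-cong (upTo k) E[R]² ⟩
  Σ[ upTo k ] (λ i → invCatalan² k *ℚ ι (A i * A i)) ≡⟨ Σ[]-*ˡ (invCatalan² k) _ (upTo k) ⟩
  invCatalan² k *ℚ Σ[ upTo k ] (λ i → ι (A i * A i))
    ≡⟨ cong (invCatalan² k *ℚ_) (Σ[]-ι (upTo k) _ (λ _ → refl)) ⟩
  invCatalan² k *ℚ ι (sumRises² k)                   ∎
  where
  open ≡-Reasoning
  open +-*-Solver using (solve; _:*_; _:=_)
  A : ℕ → ℕ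
  A i = rises (2 * k) 0 i
  E[R]² : ∀ i → E k (R i) *ℚ E k (R i) ≡ invCatalan² k *ℚ ι (A i * A i)
  E[R]² i = begin
    E k (R i) *ℚ E k (R i)                           ≡⟨ cong₂ _*ℚ_ (E-R k i) (E-R k i) ⟩
    (invCatalan k *ℚ ι (A i)) *ℚ (invCatalan k *ℚ ι (A i))
      ≡⟨ solve 2 (λ c a → (c :* a) :* (c :* a) := (c :* c) :* (a :* a)) refl (invCatalan k) (ι (A i)) ⟩
    (invCatalan k *ℚ invCatalan k) *ℚ (ι (A i) *ℚ ι (A i))
      ≡⟨ cong₂ _*ℚ_ (invCatalan*invCatalan≡invCatalan² k) (sym (ι-* (A i) (A i))) ⟩
    invCatalan² k *ℚ ι (A i * A i)                   ∎

Σ-pairs≡ι-sumRises² : ∀ k →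
  Σ[ 𝒟 k ] (λ p₁ → Σ[ 𝒟 k ] (λ p₂ → Σ[ upTo k ] (λ i → ι (R i p₁ * R i p₂)))) ≡ ι (sumRises² k)
Σ-pairs≡ι-sumRises² k = trans (Σ[]-ι (𝒟 k) _ (λ _ → Σ[]-ι (𝒟 k) _ (λ _ → Σ[]-ι (upTo k) _ (λ _ → refl))))
                              (cong ι (sum-pairs-R≡sumRises² k))

ι-sumRises²+ι-walks²≡catalanℚ : ∀ k →
  ι (sumRises² k) +ℚ ι (walks (2 * k) 0 0 * walks (2 * k) 0 0) ≡ catalanℚ (2 * k)
ι-sumRises²+ι-walks²≡catalanℚ k = trans (sym (ι-+ (sumRises² k) _))
  (trans (cong ι (sumRises²+walks²≡walks k)) (ι-walks≡catalanℚ (2 * k)))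

-- Imported only here: the prefix operator +_ would make the sections (x +_) above ambiguous.
open import Data.Integer using (+_)

theorem1 : (k : ℕ) → k ≥ 1 →
    (normSqER k
      ≡ invCatalan² k *ℚ
          Σ[ 𝒟 k ] (λ p₁ → Σ[ 𝒟 k ] (λ p₂ → Σ[ upTo k ] (λ i → (+ (R i p₁ * R i p₂)) /ℚ 1))))
    × (invCatalan² k *ℚ
          Σ[ 𝒟 k ] (λ p₁ → Σ[ 𝒟 k ] (λ p₂ → Σ[ upTo k ] (λ i → (+ (R i p₁ * R i p₂)) /ℚ 1)))
      ≡ catalanℚ (2 * k) *ℚ invCatalan² k - 1ℚ)
theorem1 k _ =
    trans (normSqER≡invCatalan²*ι-sumRises² k) (cong (invCatalan² k *ℚ_) (sym (Σ-pairs≡ι-sumRises² k)))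
  , (begin
      invCatalan² k *ℚ _
        ≡⟨ cong (invCatalan² k *ℚ_) (Σ-pairs≡ι-sumRises² k) ⟩
      invCatalan² k *ℚ ι S
        ≡⟨ solve 3 (λ x s q → x :* s := (s :+ q) :* x :- x :* q) refl (invCatalan² k) (ι S) (ι K²) ⟩
      (ι S +ℚ ι K²) *ℚ invCatalan² k - invCatalan² k *ℚ ι K²
        ≡⟨ cong₂ (λ u v → u *ℚ invCatalan² k - v) (ι-sumRises²+ι-walks²≡catalanℚ k) (invCatalan²*walks²≡1 k) ⟩
      catalanℚ (2 * k) *ℚ invCatalan² k - 1ℚ
        ∎)
  where
  open ≡-Reasoning
  open +-*-Solver using (solve; _:+_; _:*_; _:-_; _:=_)
  S = sumRises² k
  K² = walks (2 * k) 0 0 * walks (2 * k) 0 0
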